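{- Let $A$ be a (non-degenerate) open projective plane and let $<$ be an HF-ordering of $A$ over $\emptyset$. Then: (1) the set of points of $A$, and likewise the set of lines of $A$, is cofinal in $<$; (2) for every line $\ell$ of $A$, the set of points of $A$ incident with $\ell$ is cofinal in $<$, and for every point $p$ of $A$, the set of lines of $A$ incident with $p$ is cofinal in $<$.
   Context: A projective plane is a system of points and lines in which any two distinct points lie on exactly one common line and any two distinct lines meet in exactly one common point; non-degenerate means it contains four points no three of which are collinear. A projective plane $P$ is open if there is no finite subconfiguration (subset with induced incidence) $X$ of $P$ such that every element of $X$ is incident with at least three elements of $X$. An HF-ordering of $A$ over $\emptyset$ is a linear ordering $<$ of $A$ (not necessarily well-founded) such that every element of $A$ is incident with at most two $<$-smaller elements of $A$. -}

module Defs where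

open import Level using (Level; _⊔_; suc)
open import Data.Product using (Σ; ∃; _×_; _,_)
open import Data.Sum using (_⊎_; inj₁; inj₂)
open import Data.Empty using (⊥)
open import Data.Unit using (⊤)
open import Data.List using (List; [])
open import Data.List.Membership.Propositional using (_∈_)
open import Data.List.Relation.Unary.Unique.Propositional using (Unique)
open import Relation.Nullary using (¬_)
open import Relation.Binary.PropositionalEquality using (_≡_)
open import Relation.Binary.Definitions using (Trichotomous; Transitive)

record IncidenceStructure (a : Level) : Set (suc a) where
  field
    Point : Set a
    Line  : Set a
    _I_   : Point → Line → Set a

module _ {a : Level} (S : IncidenceStructure a) where
  open IncidenceStructure S

  PointsJoin : Set a
  PointsJoin = ∀ (p q : Point) → ¬ p ≡ q →
    Σ Line λ l → (p I l) × (q I l) × (∀ l' → p I l' → q I l' → l' ≡ l)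

  LinesMeet : Set a
  LinesMeet = ∀ (l m : Line) → ¬ l ≡ m →
    Σ Point λ p → (p I l) × (p I m) × (∀ p' → p' I l → p' I m → p' ≡ p)

  Collinear : Point → Point → Point → Set a
  Collinear p q r = Σ Line λ l → (p I l) × (q I l) × (r I l)

  NonDegenerate : Set a
  NonDegenerate = Σ Point λ p₁ → Σ Point λ p₂ → Σ Point λ p₃ → Σ Point λ p₄ →
    (¬ p₁ ≡ p₂) × (¬ p₁ ≡ p₃) × (¬ p₁ ≡ p₄) × (¬ p₂ ≡ p₃) × (¬ p₂ ≡ p₄) × (¬ p₃ ≡ p₄) ×
    (¬ Collinear p₁ p₂ p₃) × (¬ Collinear p₁ p₂ p₄) ×
    (¬ Collinear p₁ p₃ p₄) × (¬ Collinear p₂ p₃ p₄)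

  IsProjectivePlane : Set a
  IsProjectivePlane = PointsJoin × LinesMeet

  Elem : Set a
  Elem = Point ⊎ Line

  Inc : Elem → Elem → Set a
  Inc (inj₁ p) (inj₂ l) = p I l
  Inc (inj₂ l) (inj₁ p) = p I l
  Inc (inj₁ _) (inj₁ _) = Level.Lift a ⊥
  Inc (inj₂ _) (inj₂ _) = Level.Lift a ⊥

  AtLeastThreeInc : (Elem → Set a) → Elem → Set a
  AtLeastThreeInc Q x = Σ Elem λ y₁ → Σ Elem λ y₂ → Σ Elem λ y₃ →
    (¬ y₁ ≡ y₂) × (¬ y₁ ≡ y₃) × (¬ y₂ ≡ y₃) ×
    Q y₁ × Q y₂ × Q y₃ × Inc x y₁ × Inc x y₂ × Inc x y₃

  Closed : List Elem → Set a
  Closed X = Unique X × (¬ X ≡ []) × (∀ x → x ∈ X → AtLeastThreeInc (_∈ X) x)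

  IsOpen : Set a
  IsOpen = ∀ (X : List Elem) → ¬ Closed X

  IsStrictLinearOrder : (Elem → Elem → Set a) → Set a
  IsStrictLinearOrder _<_ = Transitive _<_ × Trichotomous _≡_ _<_

  -- HF-ordering over ∅: a linear order (not necessarily well-founded) in
  -- which every element is incident with at most two smaller elements
  IsHFOrdering : (Elem → Elem → Set a) → Set a
  IsHFOrdering _<_ = IsStrictLinearOrder _<_ ×
    (∀ x → ¬ AtLeastThreeInc (λ y → y < x) x)

  Cofinal : (Elem → Elem → Set a) → (Elem → Set a) → Set a
  Cofinal _<_ T = ∀ x → Σ Elem λ y → T y × ((x < y) ⊎ (x ≡ y))

  IsPointElem : Elem → Set a
  IsPointElem (inj₁ _) = Level.Lift a ⊤
  IsPointElem (inj₂ _) = Level.Lift a ⊥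

  IsLineElem : Elem → Set a
  IsLineElem (inj₁ _) = Level.Lift a ⊥
  IsLineElem (inj₂ _) = Level.Lift a ⊤

  PointsOn : Line → Elem → Set a
  PointsOn l (inj₁ p) = p I l
  PointsOn l (inj₂ _) = Level.Lift a ⊥

  LinesThrough : Point → Elem → Set a
  LinesThrough p (inj₁ _) = Level.Lift a ⊥
  LinesThrough p (inj₂ l) = p I l

-- In an HF-ordering an element with two smaller neighbours lies below all its other
-- neighbours.  So if r ≠ s are points off ℓ with x ≤ r, each having two smaller lines
-- not through the other, then the line rs has the two smaller points r and s, and its
-- meet with ℓ lies above rs > r ≥ x.  Such a pair is found by a finite case analysis:
-- start from a point above x, assume three points of ℓ lie below x (otherwise we are
-- done), and repeatedly join and meet, each step forcing new elements upwards.  Only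
-- three points on each line and three lines through each point are used; the
-- statement about lines through a point is the dual one.
module Submission where

open import Defs
open import Level using (Level; lift)
open import Function using (_∘_; case_of_)
open import Data.Empty using (⊥-elim)
open import Data.Unit using (tt)
open import Data.Product using (Σ; _×_; _,_; _,′_; proj₁; proj₂)
open import Data.Sum using (_⊎_; inj₁; inj₂; swap)
open import Data.Sum.Properties using (inj₁-injective; inj₂-injective; swap-involutive)
open import Relation.Nullary using (¬_; Dec; yes; no)
open import Relation.Nullary.Decidable using (map′)
open import Relation.Binary.Definitions
  using (DecidableEquality; Transitive; Trichotomous; tri<; tri≈; tri>)
open import Relation.Binary.Consequences using (tri⇒asym; tri⇒dec≈)
open import Relation.Binary.PropositionalEquality
  using (_≡_; _≢_; refl; sym; trans; cong; subst; ≢-sym)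

dual : ∀ {a} → IncidenceStructure a → IncidenceStructure a
dual A = record { Point = Line ; Line = Point ; _I_ = λ l p → p I l }
  where open IncidenceStructure A

module _ {a} (A : IncidenceStructure a) where
  open IncidenceStructure A

  record ThreePointsOn (l : Line) : Set a where
    constructor three-points
    field
      {p₁ p₂ p₃} : Point
      p₁≢p₂ : p₁ ≢ p₂
      p₁≢p₃ : p₁ ≢ p₃
      p₂≢p₃ : p₂ ≢ p₃
      p₁∈l : p₁ I l
      p₂∈l : p₂ I l
      p₃∈l : p₃ I l

Thick : ∀ {a} → IncidenceStructure a → Set a
Thick A = (∀ l → ThreePointsOn A l) × (∀ p → ThreePointsOn (dual A) p)

module _ {a} (A : IncidenceStructure a) where
  open IncidenceStructure A
  private variable
    p q r : Point
    l m : Line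

  collinear-swap : Collinear A p q r → Collinear A q p r
  collinear-swap (l , p∈l , q∈l , r∈l) = l , q∈l , p∈l , r∈l

  collinear-rotate : Collinear A p q r → Collinear A q r p
  collinear-rotate (l , p∈l , q∈l , r∈l) = l , q∈l , r∈l , p∈l

  module _ (meet : LinesMeet A) where

    point-unique : l ≢ m → p I l → p I m → q I l → q I m → p ≡ q
    point-unique {l} {m} l≢m p∈l p∈m q∈l q∈m =
      let (_ , _ , _ , unique) = meet l m l≢m
      in trans (unique _ p∈l p∈m) (sym (unique _ q∈l q∈m))

    project : ¬ q I l → ThreePointsOn (dual A) q → ThreePointsOn A l
    project {q} {l} q∉l (three-points m₁≢m₂ m₁≢m₃ m₂≢m₃ q∈m₁ q∈m₂ q∈m₃) =
      three-points (feet-≢ m₁≢m₂ q∈m₁ q∈m₂) (feet-≢ m₁≢m₃ q∈m₁ q∈m₃) (feet-≢ m₂≢m₃ q∈m₂ q∈m₃)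
        (foot∈l q∈m₁) (foot∈l q∈m₂) (foot∈l q∈m₃)
      where
      ≢l : q I m → m ≢ l
      ≢l q∈m refl = q∉l q∈m

      foot : q I m → Point
      foot q∈m = proj₁ (meet _ l (≢l q∈m))

      foot∈m : (q∈m : q I m) → foot q∈m I m
      foot∈m q∈m = let (_ , k∈m , _ , _) = meet _ l (≢l q∈m) in k∈m

      foot∈l : (q∈m : q I m) → foot q∈m I l
      foot∈l q∈m = let (_ , _ , k∈l , _) = meet _ l (≢l q∈m) in k∈l

      feet-≢ : ∀ {m m′} → m ≢ m′ → (q∈m : q I m) (q∈m′ : q I m′) → foot q∈m ≢ foot q∈m′
      feet-≢ m≢m′ q∈m q∈m′ eq = q∉l (subst (_I l) (sym q≡foot) (foot∈l q∈m))
        where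
        q≡foot : q ≡ foot q∈m
        q≡foot = point-unique m≢m′ q∈m q∈m′ (foot∈m q∈m) (subst (_I _) (sym eq) (foot∈m q∈m′))

    I-dec : DecidableEquality Point → DecidableEquality Line →
            (∀ p → Σ Line (p I_)) → ∀ p l → Dec (p I l)
    I-dec _≟ₚ_ _≟ₗ_ line-through p l with line-through p
    ... | m , p∈m with m ≟ₗ l
    ...   | yes refl = yes p∈m
    ...   | no m≢l with meet m l m≢l
    ...     | k , k∈m , k∈l , _ with p ≟ₚ k
    ...       | yes refl = yes k∈l
    ...       | no p≢k = no λ p∈l → p≢k (point-unique m≢l p∈m p∈l k∈m k∈l)

module _ {a} (A : IncidenceStructure a) (join : PointsJoin A) where
  open IncidenceStructure A
  private variable
    p q : Point
    l m : Line

  line-unique : p ≢ q → p I l → q I l → p I m → q I m → l ≡ m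
  line-unique = point-unique (dual A) join

  project-dual : ¬ p I l → ThreePointsOn A l → ThreePointsOn (dual A) p
  project-dual = project (dual A) join

  three-lines-through : ∀ {p q r s} → p ≢ q → p ≢ r → p ≢ s →
    ¬ Collinear A p q r → ¬ Collinear A p q s → ¬ Collinear A p r s → ThreePointsOn (dual A) p
  three-lines-through {p} p≢q p≢r p≢s ¬pqr ¬pqs ¬prs =
    three-points (lines-≢ p≢q p≢r ¬pqr) (lines-≢ p≢q p≢s ¬pqs) (lines-≢ p≢r p≢s ¬prs)
      (p∈ p≢q) (p∈ p≢r) (p∈ p≢s)
    where
    line : ∀ {q} → p ≢ q → Line
    line p≢q = proj₁ (join p _ p≢q)

    p∈ : ∀ {q} (p≢q : p ≢ q) → p I line p≢q
    p∈ p≢q = let (_ , p∈l , _ , _) = join p _ p≢q in p∈l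

    q∈ : ∀ {q} (p≢q : p ≢ q) → q I line p≢q
    q∈ p≢q = let (_ , _ , q∈l , _) = join p _ p≢q in q∈l

    lines-≢ : ∀ {q r} (p≢q : p ≢ q) (p≢r : p ≢ r) → ¬ Collinear A p q r → line p≢q ≢ line p≢r
    lines-≢ p≢q p≢r ¬pqr eq = ¬pqr (_ , p∈ p≢q , q∈ p≢q , subst (_ I_) (sym eq) (q∈ p≢r))

module _ {a} (A : IncidenceStructure a) (join : PointsJoin A) (meet : LinesMeet A)
  (_≟ₚ_ : DecidableEquality (IncidenceStructure.Point A))
  (_≟ₗ_ : DecidableEquality (IncidenceStructure.Line A)) where
  open IncidenceStructure A

  nonDegenerate⇒thick : NonDegenerate A → Thick A
  nonDegenerate⇒thick (p₁ , p₂ , p₃ , p₄ , p₁≢p₂ , p₁≢p₃ , p₁≢p₄ , p₂≢p₃ , p₂≢p₄ , p₃≢p₄ ,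
                       ¬123 , ¬124 , ¬134 , ¬234) = three-on , three-through
    where
    through₁ : ThreePointsOn (dual A) p₁
    through₁ = three-lines-through A join p₁≢p₂ p₁≢p₃ p₁≢p₄ ¬123 ¬124 ¬134
    through₂ : ThreePointsOn (dual A) p₂
    through₂ = three-lines-through A join (≢-sym p₁≢p₂) p₂≢p₃ p₂≢p₄
      (¬123 ∘ collinear-swap A) (¬124 ∘ collinear-swap A) ¬234
    through₃ : ThreePointsOn (dual A) p₃
    through₃ = three-lines-through A join (≢-sym p₁≢p₃) (≢-sym p₂≢p₃) p₃≢p₄
      (¬123 ∘ collinear-rotate A) (¬134 ∘ collinear-swap A) (¬234 ∘ collinear-swap A)

    line-through : ∀ p → Σ Line (p I_)
    line-through p with p ≟ₚ p₁
    ... | yes refl = _ , ThreePointsOn.p₁∈l through₁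
    ... | no p≢p₁ = let (l , p∈l , _ , _) = join p p₁ p≢p₁ in l , p∈l

    _∈?_ : ∀ p l → Dec (p I l)
    _∈?_ = I-dec A meet _≟ₚ_ _≟ₗ_ line-through

    three-on : ∀ l → ThreePointsOn A l
    three-on l with p₁ ∈? l | p₂ ∈? l | p₃ ∈? l
    ... | no p₁∉l | _ | _ = project A meet p₁∉l through₁
    ... | yes _ | no p₂∉l | _ = project A meet p₂∉l through₂
    ... | yes _ | yes _ | no p₃∉l = project A meet p₃∉l through₃
    ... | yes p₁∈l | yes p₂∈l | yes p₃∈l = ⊥-elim (¬123 (l , p₁∈l , p₂∈l , p₃∈l))

    three-through : ∀ p → ThreePointsOn (dual A) p
    three-through p with join p₁ p₂ p₁≢p₂ | join p₁ p₃ p₁≢p₃ | join p₂ p₃ p₂≢p₃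
    ... | l₁₂ , p₁∈l₁₂ , p₂∈l₁₂ , _ | l₁₃ , p₁∈l₁₃ , p₃∈l₁₃ , _ | l₂₃ , p₂∈l₂₃ , p₃∈l₂₃ , _
      with p ∈? l₁₂ | p ∈? l₁₃
    ... | no p∉l₁₂ | _ = project-dual A join p∉l₁₂ (three-on l₁₂)
    ... | yes _ | no p∉l₁₃ = project-dual A join p∉l₁₃ (three-on l₁₃)
    ... | yes p∈l₁₂ | yes p∈l₁₃ = project-dual A join p∉l₂₃ (three-on l₂₃)
      where
      l₁₂≢l₁₃ : l₁₂ ≢ l₁₃
      l₁₂≢l₁₃ eq = ¬123 (l₁₂ , p₁∈l₁₂ , p₂∈l₁₂ , subst (p₃ I_) (sym eq) p₃∈l₁₃)

      p∉l₂₃ : ¬ p I l₂₃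
      p∉l₂₃ p∈l₂₃ = ¬123 (l₂₃ , subst (_I l₂₃) p≡p₁ p∈l₂₃ , p₂∈l₂₃ , p₃∈l₂₃)
        where
        p≡p₁ : p ≡ p₁
        p≡p₁ = point-unique A meet l₁₂≢l₁₃ p∈l₁₂ p∈l₁₃ p₁∈l₁₂ p₁∈l₁₃

module _ {a} (A : IncidenceStructure a) (_<_ : Elem A → Elem A → Set a) where
  open IncidenceStructure A

  _<ᵈ_ : Elem (dual A) → Elem (dual A) → Set a
  x <ᵈ y = swap x < swap y

  private
    swap-injective : ∀ {x y : Elem (dual A)} → swap x ≡ swap y → x ≡ y
    swap-injective {x} {y} eq =
      trans (sym (swap-involutive x)) (trans (cong swap eq) (swap-involutive y))

    Inc-swap : ∀ x y → Inc (dual A) x y → Inc A (swap x) (swap y)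
    Inc-swap (inj₁ _) (inj₁ _) i = i
    Inc-swap (inj₁ _) (inj₂ _) i = i
    Inc-swap (inj₂ _) (inj₁ _) i = i
    Inc-swap (inj₂ _) (inj₂ _) i = i

  dual-isHFOrdering : IsHFOrdering A _<_ → IsHFOrdering (dual A) _<ᵈ_
  dual-isHFOrdering ((<-trans , <-tri) , hf) = (<-trans , <ᵈ-tri) , hfᵈ
    where
    <ᵈ-tri : Trichotomous _≡_ _<ᵈ_
    <ᵈ-tri x y with <-tri (swap x) (swap y)
    ... | tri< x<y x≢y y≮x = tri< x<y (x≢y ∘ cong swap) y≮x
    ... | tri≈ x≮y x≡y y≮x = tri≈ x≮y (swap-injective x≡y) y≮x
    ... | tri> x≮y x≢y y<x = tri> x≮y (x≢y ∘ cong swap) y<x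

    hfᵈ : ∀ x → ¬ AtLeastThreeInc (dual A) (_<ᵈ x) x
    hfᵈ x (y₁ , y₂ , y₃ , y₁≢y₂ , y₁≢y₃ , y₂≢y₃ , y₁<x , y₂<x , y₃<x , i₁ , i₂ , i₃) =
      hf (swap x) (swap y₁ , swap y₂ , swap y₃ ,
                   y₁≢y₂ ∘ swap-injective , y₁≢y₃ ∘ swap-injective , y₂≢y₃ ∘ swap-injective ,
                   y₁<x , y₂<x , y₃<x , Inc-swap x y₁ i₁ , Inc-swap x y₂ i₂ , Inc-swap x y₃ i₃)

  cofinal-from-dual : ∀ {p} →
    Cofinal (dual A) _<ᵈ_ (PointsOn (dual A) p) → Cofinal A _<_ (LinesThrough A p)
  cofinal-from-dual cofinal x with cofinal (swap x)
  ... | inj₁ l , p∈l , inj₁ x<l = inj₂ l , p∈l , inj₁ (subst (_< inj₂ l) (swap-involutive x) x<l)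
  ... | inj₁ l , p∈l , inj₂ x≡l = inj₂ l , p∈l , inj₂ (trans (sym (swap-involutive x)) (cong swap x≡l))
  ... | inj₂ _ , lift () , _

module _ {a} (A : IncidenceStructure a) (_≟_ : DecidableEquality (Elem A)) where
  open IncidenceStructure A

  point-≟ : DecidableEquality Point
  point-≟ p q = map′ inj₁-injective (cong inj₁) (inj₁ p ≟ inj₁ q)

  line-≟ : DecidableEquality Line
  line-≟ l m = map′ inj₂-injective (cong inj₂) (inj₂ l ≟ inj₂ m)

cofinal-⊆ : ∀ {a} {A : IncidenceStructure a} {_<_ : Elem A → Elem A → Set a} {S T : Elem A → Set a} →
  (∀ {y} → S y → T y) → Cofinal A _<_ S → Cofinal A _<_ T
cofinal-⊆ S⊆T cofinal x = let (y , y∈S , x≤y) = cofinal x in y , S⊆T y∈S , x≤y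

module Cofinality {a} (A : IncidenceStructure a) (join : PointsJoin A) (meet : LinesMeet A)
  (three-points-on : ∀ l → ThreePointsOn A l) (three-lines-through : ∀ p → ThreePointsOn (dual A) p)
  (_<_ : Elem A → Elem A → Set a) (<-trans : Transitive _<_) (<-tri : Trichotomous _≡_ _<_)
  (hf : ∀ e → ¬ AtLeastThreeInc A (_< e) e) where
  open IncidenceStructure A

  private variable
    p q r s t u v β γ : Point
    l m b₁ b₂ b₃ b₄ : Line
    e f g f₁ f₂ f₃ : Elem A

  pt : Point → Elem A
  pt = inj₁

  ln : Line → Elem A
  ln = inj₂

  _≤_ : Elem A → Elem A → Set a
  e ≤ f = e < f ⊎ e ≡ f

  ≤-<-trans : e ≤ f → f < g → e < g
  ≤-<-trans (inj₁ e<f) f<g = <-trans e<f f<g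
  ≤-<-trans (inj₂ refl) f<g = f<g

  <-asym : e < f → ¬ f < e
  <-asym = tri⇒asym <-tri

  <⇒≢ : e < f → e ≢ f
  <⇒≢ e<e refl = <-asym e<e e<e

  Inc-irrefl : ¬ Inc A e e
  Inc-irrefl {inj₁ _} (lift ())
  Inc-irrefl {inj₂ _} (lift ())

  pt-≢ : p ≢ q → pt p ≢ pt q
  pt-≢ p≢q = p≢q ∘ inj₁-injective

  ln-≢ : l ≢ m → ln l ≢ ln m
  ln-≢ l≢m = l≢m ∘ inj₂-injective

  _≟ₚ_ : DecidableEquality Point
  _≟ₚ_ = point-≟ A (tri⇒dec≈ <-tri)

  _≟ₗ_ : DecidableEquality Line
  _≟ₗ_ = line-≟ A (tri⇒dec≈ <-tri)

  _∈?_ : ∀ p l → Dec (p I l)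
  _∈?_ = I-dec A meet _≟ₚ_ _≟ₗ_ λ p → _ , ThreePointsOn.p₁∈l (three-lines-through p)

  pt-ln-compare : ∀ p l → pt p < ln l ⊎ ln l < pt p
  pt-ln-compare p l with <-tri (pt p) (ln l)
  ... | tri< p<l _ _ = inj₁ p<l
  ... | tri≈ _ () _
  ... | tri> _ _ l<p = inj₂ l<p

  above-third : f₁ ≢ f₂ → f₁ ≢ f₃ → f₂ ≢ f₃ → Inc A e f₁ → Inc A e f₂ → Inc A e f₃ →
                f₁ < e → f₂ < e → e < f₃
  above-third {f₁} {f₂} {f₃} {e} f₁≢f₂ f₁≢f₃ f₂≢f₃ i₁ i₂ i₃ f₁<e f₂<e with <-tri e f₃
  ... | tri< e<f₃ _ _ = e<f₃
  ... | tri≈ _ refl _ = ⊥-elim (Inc-irrefl {e = f₃} i₃)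
  ... | tri> _ _ f₃<e =
    ⊥-elim (hf e (f₁ , f₂ , f₃ , f₁≢f₂ , f₁≢f₃ , f₂≢f₃ , f₁<e , f₂<e , f₃<e , i₁ , i₂ , i₃))

  below-greatest : f₁ ≢ f₂ → f₁ ≢ f₃ → f₂ ≢ f₃ → Inc A e f₁ → Inc A e f₂ → Inc A e f₃ →
                   f₁ < f₃ → f₂ < f₃ → e < f₃
  below-greatest {f₁} {f₂} {f₃} {e} f₁≢f₂ f₁≢f₃ f₂≢f₃ i₁ i₂ i₃ f₁<f₃ f₂<f₃ with <-tri e f₃
  ... | tri< e<f₃ _ _ = e<f₃
  ... | tri≈ _ refl _ = ⊥-elim (Inc-irrefl {e = f₃} i₃)
  ... | tri> _ _ f₃<e = ⊥-elim (hf e (f₁ , f₂ , f₃ , f₁≢f₂ , f₁≢f₃ , f₂≢f₃ ,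
                                     <-trans f₁<f₃ f₃<e , <-trans f₂<f₃ f₃<e , f₃<e , i₁ , i₂ , i₃))

  line-below-third : q ≢ r → q ≢ s → r ≢ s → q I l → r I l → s I l →
                     pt q < ln l → pt r < ln l → ln l < pt s
  line-below-third q≢r q≢s r≢s = above-third (pt-≢ q≢r) (pt-≢ q≢s) (pt-≢ r≢s)

  ≢-line : ¬ q I l → q I m → l ≢ m
  ≢-line q∉l q∈m refl = q∉l q∈m

  ≢-point : ¬ q I l → p I l → q ≢ p
  ≢-point q∉l p∈l refl = q∉l p∈l

  record Saturated (p : Point) (b₁ b₂ : Line) : Set a where
    constructor saturated
    field
      b₁≢b₂ : b₁ ≢ b₂
      p∈b₁ : p I b₁
      p∈b₂ : p I b₂
      b₁<p : ln b₁ < pt p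
      b₂<p : ln b₂ < pt p

    below-line-to : q I m → p I m → ¬ q I b₁ → ¬ q I b₂ → pt p < ln m
    below-line-to q∈m p∈m q∉b₁ q∉b₂ =
      above-third (ln-≢ b₁≢b₂) (ln-≢ (≢-line q∉b₁ q∈m)) (ln-≢ (≢-line q∉b₂ q∈m)) p∈b₁ p∈b₂ p∈m b₁<p b₂<p

  open Saturated

  swap-saturated : Saturated p b₁ b₂ → Saturated p b₂ b₁
  swap-saturated (saturated b₁≢b₂ p∈b₁ p∈b₂ b₁<p b₂<p) = saturated (≢-sym b₁≢b₂) p∈b₂ p∈b₁ b₂<p b₁<p

  point-above : ∀ l → Σ Point λ q → ln l < pt q
  point-above l with three-points-on l
  ... | three-points {q₁} {q₂} {q₃} q₁≢q₂ q₁≢q₃ q₂≢q₃ q₁∈l q₂∈l q₃∈l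
    with pt-ln-compare q₁ l | pt-ln-compare q₂ l
  ... | inj₂ l<q₁ | _ = q₁ , l<q₁
  ... | _ | inj₂ l<q₂ = q₂ , l<q₂
  ... | inj₁ q₁<l | inj₁ q₂<l = q₃ , line-below-third q₁≢q₂ q₁≢q₃ q₂≢q₃ q₁∈l q₂∈l q₃∈l q₁<l q₂<l

  point-avoiding : ∀ l u v → Σ Point λ w → w I l × w ≢ u × w ≢ v
  point-avoiding l u v with three-points-on l
  ... | three-points {q₁} {q₂} {q₃} q₁≢q₂ q₁≢q₃ q₂≢q₃ q₁∈l q₂∈l q₃∈l with q₁ ≟ₚ u | q₁ ≟ₚ v
  ... | no q₁≢u | no q₁≢v = q₁ , q₁∈l , q₁≢u , q₁≢v
  ... | yes refl | _ with q₂ ≟ₚ v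
  ...   | no q₂≢v = q₂ , q₂∈l , ≢-sym q₁≢q₂ , q₂≢v
  ...   | yes refl = q₃ , q₃∈l , ≢-sym q₁≢q₃ , ≢-sym q₂≢q₃
  point-avoiding l u v | three-points {q₁} {q₂} {q₃} q₁≢q₂ q₁≢q₃ q₂≢q₃ q₁∈l q₂∈l q₃∈l
    | no _ | yes refl with q₂ ≟ₚ u
  ...   | no q₂≢u = q₂ , q₂∈l , q₂≢u , ≢-sym q₁≢q₂
  ...   | yes refl = q₃ , q₃∈l , ≢-sym q₂≢q₃ , ≢-sym q₁≢q₃

  module OnLineAbove (ℓ : Line) (x : Elem A) where

    Goal : Set a
    Goal = Σ Point λ t → t I ℓ × x ≤ pt t

    above-x-or : t I ℓ → (pt t < x → Goal) → Goal
    above-x-or {t} t∈ℓ otherwise with <-tri x (pt t)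
    ... | tri< x<t _ _ = t , t∈ℓ , inj₁ x<t
    ... | tri≈ _ x≡t _ = t , t∈ℓ , inj₂ x≡t
    ... | tri> _ _ t<x = otherwise t<x

    meets-ℓ-once : ¬ r I ℓ → r I m → u I ℓ → u I m → v I ℓ → v I m → u ≡ v
    meets-ℓ-once r∉ℓ r∈m = point-unique A meet (≢-line r∉ℓ r∈m)

    only-foot : ¬ r I ℓ → r I m → β I ℓ → β I m → γ I ℓ → β ≢ γ → ¬ γ I m
    only-foot r∉ℓ r∈m β∈ℓ β∈m γ∈ℓ β≢γ γ∈m = β≢γ (meets-ℓ-once r∉ℓ r∈m β∈ℓ β∈m γ∈ℓ γ∈m)

    line-to-ℓ : ¬ r I ℓ → β I ℓ → Σ Line λ m → r I m × β I m
    line-to-ℓ r∉ℓ β∈ℓ = let (m , r∈m , β∈m , _) = join _ _ (≢-point r∉ℓ β∈ℓ) in m , r∈m , β∈m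

    from-saturated-pair : Saturated r b₁ b₂ → Saturated s b₃ b₄ → ¬ r I ℓ → ¬ s I ℓ → x ≤ pt r →
             ¬ s I b₁ → ¬ s I b₂ → ¬ r I b₃ → ¬ r I b₄ → Goal
    from-saturated-pair {r} {s = s} R S r∉ℓ s∉ℓ x≤r s∉b₁ s∉b₂ r∉b₃ r∉b₄
      with join r s (≢-sym (≢-point s∉b₁ (p∈b₁ R)))
    ... | u , r∈u , s∈u , _ with meet ℓ u (≢-line r∉ℓ r∈u)
    ...   | t , t∈ℓ , t∈u , _ = t , t∈ℓ , inj₁ (≤-<-trans x≤r (<-trans r<u u<t))
      where
      r<u : pt r < ln u
      r<u = below-line-to R s∈u r∈u s∉b₁ s∉b₂

      u<t : ln u < pt t
      u<t = line-below-third (≢-sym (≢-point s∉b₁ (p∈b₁ R))) (≢-point r∉ℓ t∈ℓ) (≢-point s∉ℓ t∈ℓ)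
              r∈u s∈u t∈u r<u (below-line-to S r∈u s∈u r∉b₃ r∉b₄)

    -- The next line is always drawn through the foot τ; the roles of the three feet
    -- are permuted as the construction proceeds.
    record Feet : Set a where
      constructor feet
      field
        {τ α₁ α₂} : Point
        τ∈ℓ : τ I ℓ
        α₁∈ℓ : α₁ I ℓ
        α₂∈ℓ : α₂ I ℓ
        τ≢α₁ : τ ≢ α₁
        τ≢α₂ : τ ≢ α₂
        α₁≢α₂ : α₁ ≢ α₂
        τ<x : pt τ < x
        α₁<x : pt α₁ < x
        α₂<x : pt α₂ < x

    swap-α : Feet → Feet
    swap-α (feet τ∈ℓ α₁∈ℓ α₂∈ℓ τ≢α₁ τ≢α₂ α₁≢α₂ τ<x α₁<x α₂<x) =
      feet τ∈ℓ α₂∈ℓ α₁∈ℓ τ≢α₂ τ≢α₁ (≢-sym α₁≢α₂) τ<x α₂<x α₁<x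

    swap-τα₂ : Feet → Feet
    swap-τα₂ (feet τ∈ℓ α₁∈ℓ α₂∈ℓ τ≢α₁ τ≢α₂ α₁≢α₂ τ<x α₁<x α₂<x) =
      feet α₂∈ℓ α₁∈ℓ τ∈ℓ (≢-sym α₁≢α₂) (≢-sym τ≢α₂) (≢-sym τ≢α₁) α₂<x α₁<x τ<x

    record Fan (F : Feet) (r y : Point) (c a₁ a₂ d₁ d₂ : Line) : Set a where
      constructor mkFan
      open Feet F
      field
        r∉ℓ : ¬ r I ℓ
        y∉ℓ : ¬ y I ℓ
        x≤r : x ≤ pt r
        r<y : pt r < pt y
        r∈c : r I c
        τ∈c : τ I c
        y∈c : y I c
        r∈a₁ : r I a₁
        α₁∈a₁ : α₁ I a₁
        r∈a₂ : r I a₂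
        α₂∈a₂ : α₂ I a₂
        y∈d₁ : y I d₁
        α₁∈d₁ : α₁ I d₁
        y∈d₂ : y I d₂
        α₂∈d₂ : α₂ I d₂

      x≤y : x ≤ pt y
      x≤y = inj₁ (≤-<-trans x≤r r<y)

      α₁∉c : ¬ α₁ I c
      α₁∉c = only-foot r∉ℓ r∈c τ∈ℓ τ∈c α₁∈ℓ τ≢α₁

      α₂∉c : ¬ α₂ I c
      α₂∉c = only-foot r∉ℓ r∈c τ∈ℓ τ∈c α₂∈ℓ τ≢α₂

      α₁∉a₂ : ¬ α₁ I a₂
      α₁∉a₂ = only-foot r∉ℓ r∈a₂ α₂∈ℓ α₂∈a₂ α₁∈ℓ (≢-sym α₁≢α₂)

      α₂∉a₁ : ¬ α₂ I a₁
      α₂∉a₁ = only-foot r∉ℓ r∈a₁ α₁∈ℓ α₁∈a₁ α₂∈ℓ α₁≢α₂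

      α₂∉d₁ : ¬ α₂ I d₁
      α₂∉d₁ = only-foot y∉ℓ y∈d₁ α₁∈ℓ α₁∈d₁ α₂∈ℓ α₁≢α₂

      τ∉a₁ : ¬ τ I a₁
      τ∉a₁ = only-foot r∉ℓ r∈a₁ α₁∈ℓ α₁∈a₁ τ∈ℓ (≢-sym τ≢α₁)

      τ∉a₂ : ¬ τ I a₂
      τ∉a₂ = only-foot r∉ℓ r∈a₂ α₂∈ℓ α₂∈a₂ τ∈ℓ (≢-sym τ≢α₂)

      τ∉d₁ : ¬ τ I d₁
      τ∉d₁ = only-foot y∉ℓ y∈d₁ α₁∈ℓ α₁∈d₁ τ∈ℓ (≢-sym τ≢α₁)

      τ∉d₂ : ¬ τ I d₂
      τ∉d₂ = only-foot y∉ℓ y∈d₂ α₂∈ℓ α₂∈d₂ τ∈ℓ (≢-sym τ≢α₂)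

      c-through-r-y : r I m → y I m → m ≡ c
      c-through-r-y r∈m y∈m = line-unique A join (<⇒≢ r<y ∘ cong pt) r∈m y∈m r∈c y∈c

      y∉a₂ : ¬ y I a₂
      y∉a₂ y∈a₂ = α₂∉c (subst (α₂ I_) (c-through-r-y r∈a₂ y∈a₂) α₂∈a₂)

      r∉d₁ : ¬ r I d₁
      r∉d₁ r∈d₁ = α₁∉c (subst (α₁ I_) (c-through-r-y r∈d₁ y∈d₁) α₁∈d₁)

      d₁≢a₂ : d₁ ≢ a₂
      d₁≢a₂ = ≢-sym (≢-line α₁∉a₂ α₁∈d₁)

      y-below-d₂ : ln c < pt y → ln d₁ < pt y → pt y < ln d₂
      y-below-d₂ c<y d₁<y =
        below-line-to (saturated (≢-line α₁∉c α₁∈d₁) y∈c y∈d₁ c<y d₁<y) α₂∈d₂ y∈d₂ α₂∉c α₂∉d₁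

    swap-fan : ∀ {F r y c a₁ a₂ d₁ d₂} → Fan F r y c a₁ a₂ d₁ d₂ → Fan (swap-α F) r y c a₂ a₁ d₂ d₁
    swap-fan {feet _ _ _ _ _ _ _ _ _}
      (mkFan r∉ℓ y∉ℓ x≤r r<y r∈c τ∈c y∈c r∈a₁ α₁∈a₁ r∈a₂ α₂∈a₂ y∈d₁ α₁∈d₁ y∈d₂ α₂∈d₂) =
      mkFan r∉ℓ y∉ℓ x≤r r<y r∈c τ∈c y∈c r∈a₂ α₂∈a₂ r∈a₁ α₁∈a₁ y∈d₂ α₂∈d₂ y∈d₁ α₁∈d₁

    module _ {F r y c a₁ a₂ d₁ d₂} (fan : Fan F r y c a₁ a₂ d₁ d₂) where
      open Feet F
      open Fan fan

      corner : pt y < ln d₁ →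
               Σ Point λ z → Saturated z d₁ a₂ × pt r < pt z × ¬ z I ℓ × ¬ z I d₂ × ¬ z I a₁
      corner y<d₁ with meet d₁ a₂ d₁≢a₂
      ... | z , z∈d₁ , z∈a₂ , _ =
        z , saturated d₁≢a₂ z∈d₁ z∈a₂ d₁<z a₂<z , r<z , z∉ℓ , z∉d₂ , z∉a₁
        where
        y≢z : y ≢ z
        y≢z = ≢-point y∉a₂ z∈a₂

        r≢z : r ≢ z
        r≢z = ≢-point r∉d₁ z∈d₁

        d₁<z : ln d₁ < pt z
        d₁<z = line-below-third (≢-point y∉ℓ α₁∈ℓ) y≢z (≢-point α₁∉a₂ z∈a₂) y∈d₁ α₁∈d₁ z∈d₁
                 y<d₁ (<-trans α₁<x (≤-<-trans x≤r (<-trans r<y y<d₁)))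

        r<z : pt r < pt z
        r<z = <-trans r<y (<-trans y<d₁ d₁<z)

        a₂<z : ln a₂ < pt z
        a₂<z = below-greatest (pt-≢ (≢-point r∉ℓ α₂∈ℓ)) (pt-≢ r≢z) (pt-≢ (≢-point α₂∉d₁ z∈d₁))
                 r∈a₂ α₂∈a₂ z∈a₂ r<z (<-trans α₂<x (≤-<-trans x≤r r<z))

        z∉ℓ : ¬ z I ℓ
        z∉ℓ z∈ℓ = ≢-point α₁∉a₂ z∈a₂ (meets-ℓ-once y∉ℓ y∈d₁ α₁∈ℓ α₁∈d₁ z∈ℓ z∈d₁)

        z∉d₂ : ¬ z I d₂
        z∉d₂ z∈d₂ = y≢z (point-unique A meet (≢-line α₂∉d₁ α₂∈d₂) y∈d₁ y∈d₂ z∈d₁ z∈d₂)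

        z∉a₁ : ¬ z I a₁
        z∉a₁ z∈a₁ = r≢z (point-unique A meet (≢-line α₂∉a₁ α₂∈a₂) r∈a₁ r∈a₂ z∈a₁ z∈a₂)

    module _ {F r y c a₁ a₂ d₁ d₂} (fan : Fan F r y c a₁ a₂ d₁ d₂) where
      open Feet F
      open Fan fan

      both-above : pt y < ln d₁ → pt y < ln d₂ → Goal
      both-above y<d₁ y<d₂ with corner fan y<d₁ | corner (swap-fan fan) y<d₂
      ... | z₁ , Z₁ , r<z₁ , z₁∉ℓ , z₁∉d₂ , z₁∉a₁ | z₂ , Z₂ , _ , z₂∉ℓ , z₂∉d₁ , z₂∉a₂ =
        from-saturated-pair Z₁ Z₂ z₁∉ℓ z₂∉ℓ (inj₁ (≤-<-trans x≤r r<z₁)) z₂∉d₁ z₂∉a₂ z₁∉d₂ z₁∉a₁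

      both-saturated : Saturated r a₁ a₂ → ln c < pt y → ln d₁ < pt y → Goal
      both-saturated R c<y d₁<y with corner (swap-fan fan) (y-below-d₂ c<y d₁<y)
      ... | z , Z , r<z , z∉ℓ , z∉d₁ , z∉a₂ with line-to-ℓ z∉ℓ τ∈ℓ
      ...   | e , z∈e , τ∈e with meet e a₂ (≢-sym (≢-line τ∉a₂ τ∈e))
      ...     | p , p∈e , p∈a₂ , _ =
        from-saturated-pair P Y p∉ℓ y∉ℓ (inj₁ (≤-<-trans x≤r r<p)) y∉e y∉a₂ p∉c p∉d₁
        where
        Y : Saturated y c d₁
        Y = saturated (≢-line α₁∉c α₁∈d₁) y∈c y∈d₁ c<y d₁<y

        z<e : pt z < ln e
        z<e = below-line-to Z τ∈e z∈e τ∉d₂ τ∉a₁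

        τ≢p : τ ≢ p
        τ≢p = ≢-point τ∉a₂ p∈a₂

        e<p : ln e < pt p
        e<p = line-below-third (≢-point z∉ℓ τ∈ℓ) (≢-point z∉a₂ p∈a₂) τ≢p z∈e τ∈e p∈e
                z<e (<-trans τ<x (≤-<-trans x≤r (<-trans r<z z<e)))

        r<p : pt r < pt p
        r<p = <-trans r<z (<-trans z<e e<p)

        P : Saturated p e a₂
        P = saturated (≢-sym (≢-line τ∉a₂ τ∈e)) p∈e p∈a₂ e<p (<-trans (b₂<p R) r<p)

        p∉ℓ : ¬ p I ℓ
        p∉ℓ p∈ℓ = τ≢p (meets-ℓ-once z∉ℓ z∈e τ∈ℓ τ∈e p∈ℓ p∈e)

        e≢c : e ≢ c
        e≢c refl = <⇒≢ r<z (cong pt (sym z≡r))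
          where
          z≡r : z ≡ r
          z≡r = point-unique A meet (≢-line α₁∉c α₁∈a₁) z∈e (p∈b₂ Z) r∈c r∈a₁

        y∉e : ¬ y I e
        y∉e y∈e = e≢c (line-unique A join (≢-point y∉ℓ τ∈ℓ) y∈e τ∈e y∈c τ∈c)

        p∉c : ¬ p I c
        p∉c p∈c = e≢c (line-unique A join (≢-sym τ≢p) p∈e τ∈e p∈c τ∈c)

        p∉d₁ : ¬ p I d₁
        p∉d₁ p∈d₁ = <-asym (below-line-to P y∈d₁ p∈d₁ y∉e y∉a₂) (<-trans d₁<y y<p)
          where
          y<p : pt y < pt p
          y<p = <-trans (y-below-d₂ c<y d₁<y) (<-trans (b₁<p Z) (<-trans z<e e<p))

    Climb : Feet → Point → Line → Line → Line → Set a
    Climb F r c a₁ a₂ = Σ Point λ y → Σ Line λ d₁ → Σ Line λ d₂ → Fan F r y c a₁ a₂ d₁ d₂ × ln c < pt y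

    climb : (F : Feet) → ¬ r I ℓ → x ≤ pt r → r I m → Feet.τ F I m → pt r < ln m →
            r I b₁ → Feet.α₁ F I b₁ → r I b₂ → Feet.α₂ F I b₂ → Climb F r m b₁ b₂
    climb {r = r} {m = c} F r∉ℓ x≤r r∈c τ∈c r<c r∈a₁ α₁∈a₁ r∈a₂ α₂∈a₂ with point-avoiding c r (Feet.τ F)
    ... | y , y∈c , y≢r , y≢τ =
      let (d₁ , y∈d₁ , α₁∈d₁) = line-to-ℓ y∉ℓ α₁∈ℓ
          (d₂ , y∈d₂ , α₂∈d₂) = line-to-ℓ y∉ℓ α₂∈ℓ
      in y , d₁ , d₂ ,
         mkFan r∉ℓ y∉ℓ x≤r (<-trans r<c c<y) r∈c τ∈c y∈c r∈a₁ α₁∈a₁ r∈a₂ α₂∈a₂ y∈d₁ α₁∈d₁ y∈d₂ α₂∈d₂ ,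
         c<y
      where
      open Feet F

      y∉ℓ : ¬ y I ℓ
      y∉ℓ y∈ℓ = y≢τ (meets-ℓ-once r∉ℓ r∈c y∈ℓ y∈c τ∈ℓ τ∈c)

      c<y : ln c < pt y
      c<y = line-below-third (≢-point r∉ℓ τ∈ℓ) (≢-sym y≢r) (≢-sym y≢τ) r∈c τ∈c y∈c
              r<c (<-trans τ<x (≤-<-trans x≤r r<c))

    after-climb-saturated : ∀ {F} → Saturated r b₁ b₂ → Climb F r m b₁ b₂ → Goal
    after-climb-saturated R (y , d₁ , d₂ , fan , c<y) =
      case pt-ln-compare y d₁ ,′ pt-ln-compare y d₂ of λ where
        (inj₁ y<d₁ , inj₁ y<d₂) → both-above fan y<d₁ y<d₂
        (inj₂ d₁<y , _) → both-saturated fan R c<y d₁<y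
        (inj₁ _ , inj₂ d₂<y) → both-saturated (swap-fan fan) (swap-saturated R) c<y d₂<y

    from-saturated : (F : Feet) → ¬ r I ℓ → x ≤ pt r → Saturated r b₁ b₂ →
                     Feet.α₁ F I b₁ → Feet.α₂ F I b₂ → Goal
    from-saturated {r = r} F r∉ℓ x≤r R α₁∈a₁ α₂∈a₂ =
      let (c , r∈c , τ∈c) = line-to-ℓ r∉ℓ τ∈ℓ
      in after-climb-saturated R
           (climb F r∉ℓ x≤r r∈c τ∈c (r<line-to-τ r∈c τ∈c) (p∈b₁ R) α₁∈a₁ (p∈b₂ R) α₂∈a₂)
      where
      open Feet F

      r<line-to-τ : r I m → τ I m → pt r < ln m
      r<line-to-τ r∈m τ∈m = below-line-to R τ∈m r∈m
        (only-foot r∉ℓ (p∈b₁ R) α₁∈ℓ α₁∈a₁ τ∈ℓ (≢-sym τ≢α₁))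
        (only-foot r∉ℓ (p∈b₂ R) α₂∈ℓ α₂∈a₂ τ∈ℓ (≢-sym τ≢α₂))

    after-climb : ∀ {F} → Climb F r m b₁ b₂ → Goal
    after-climb {F = F} (y , d₁ , d₂ , fan , c<y) =
      case pt-ln-compare y d₁ ,′ pt-ln-compare y d₂ of λ where
        (inj₁ y<d₁ , inj₁ y<d₂) → both-above fan y<d₁ y<d₂
        (inj₂ d₁<y , _) → from-saturated (swap-τα₂ F) y∉ℓ x≤y
          (saturated (≢-line τ∉d₁ τ∈c) y∈d₁ y∈c d₁<y c<y) α₁∈d₁ τ∈c
        (inj₁ _ , inj₂ d₂<y) → from-saturated (swap-τα₂ (swap-α F)) y∉ℓ x≤y
          (saturated (≢-line τ∉d₂ τ∈c) y∈d₂ y∈c d₂<y c<y) α₂∈d₂ τ∈c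
      where
      open Feet F
      open Fan fan

    from-climbing : (F : Feet) → ¬ r I ℓ → x ≤ pt r → r I m → Feet.τ F I m → pt r < ln m → Goal
    from-climbing F r∉ℓ x≤r r∈c τ∈c r<c =
      let (a₁ , r∈a₁ , α₁∈a₁) = line-to-ℓ r∉ℓ α₁∈ℓ
          (a₂ , r∈a₂ , α₂∈a₂) = line-to-ℓ r∉ℓ α₂∈ℓ
      in after-climb (climb F r∉ℓ x≤r r∈c τ∈c r<c r∈a₁ α₁∈a₁ r∈a₂ α₂∈a₂)
      where open Feet F

    from-feet : ¬ q I ℓ → x ≤ pt q → Feet → Goal
    from-feet {q = q} q∉ℓ x≤q F =
      let (n₁ , q∈n₁ , τ∈n₁) = line-to-ℓ q∉ℓ τ∈ℓ
          (n₂ , q∈n₂ , α₂∈n₂) = line-to-ℓ q∉ℓ α₂∈ℓ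
          n₂≢n₁ : n₂ ≢ n₁
          n₂≢n₁ = ≢-line (only-foot q∉ℓ q∈n₂ α₂∈ℓ α₂∈n₂ τ∈ℓ (≢-sym τ≢α₂)) τ∈n₁
      in case pt-ln-compare q n₁ ,′ pt-ln-compare q n₂ of λ where
        (inj₁ q<n₁ , _) → from-climbing F q∉ℓ x≤q q∈n₁ τ∈n₁ q<n₁
        (inj₂ _ , inj₁ q<n₂) → from-climbing (swap-τα₂ F) q∉ℓ x≤q q∈n₂ α₂∈n₂ q<n₂
        (inj₂ n₁<q , inj₂ n₂<q) → from-saturated (swap-τα₂ (swap-α F)) q∉ℓ x≤q
          (saturated n₂≢n₁ q∈n₂ q∈n₁ n₂<q n₁<q) α₂∈n₂ τ∈n₁
      where open Feet F

    from-point-above : x ≤ pt q → Goal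
    from-point-above {q = q} x≤q with q ∈? ℓ | three-points-on ℓ
    ... | yes q∈ℓ | _ = q , q∈ℓ , x≤q
    ... | no q∉ℓ | three-points t₁≢t₂ t₁≢t₃ t₂≢t₃ t₁∈ℓ t₂∈ℓ t₃∈ℓ =
      above-x-or t₁∈ℓ λ t₁<x → above-x-or t₂∈ℓ λ t₂<x → above-x-or t₃∈ℓ λ t₃<x →
      from-feet q∉ℓ x≤q (feet t₁∈ℓ t₂∈ℓ t₃∈ℓ t₁≢t₂ t₁≢t₃ t₂≢t₃ t₁<x t₂<x t₃<x)

  point-at-or-above : ∀ e → Σ Point λ q → e ≤ pt q
  point-at-or-above (inj₁ p) = p , inj₂ refl
  point-at-or-above (inj₂ l) = let (q , l<q) = point-above l in q , inj₁ l<q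

  cofinal : ∀ ℓ → Cofinal A _<_ (PointsOn A ℓ)
  cofinal ℓ x =
    let (q , x≤q) = point-at-or-above x
        (t , t∈ℓ , x≤t) = OnLineAbove.from-point-above ℓ x x≤q
    in pt t , t∈ℓ , x≤t

pointsOn-cofinal : ∀ {a} {A : IncidenceStructure a} {_<_ : Elem A → Elem A → Set a} →
  IsProjectivePlane A → Thick A → IsHFOrdering A _<_ → ∀ l → Cofinal A _<_ (PointsOn A l)
pointsOn-cofinal {A = A} {_<_} (join , meet) (on , through) ((<-trans , <-tri) , hf) =
  Cofinality.cofinal A join meet on through _<_ <-trans <-tri hf

linesThrough-cofinal : ∀ {a} {A : IncidenceStructure a} {_<_ : Elem A → Elem A → Set a} →
  IsProjectivePlane A → Thick A → IsHFOrdering A _<_ → ∀ p → Cofinal A _<_ (LinesThrough A p)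
linesThrough-cofinal {A = A} {_<_} (join , meet) (on , through) hf p =
  cofinal-from-dual A _<_ (pointsOn-cofinal (meet , join) (through , on) (dual-isHFOrdering A _<_ hf) p)

lemma4p3 : ∀ {a : Level} (A : IncidenceStructure a) →
    IsProjectivePlane A → NonDegenerate A → IsOpen A →
    (_<_ : Elem A → Elem A → Set a) → IsHFOrdering A _<_ →
    (Cofinal A _<_ (IsPointElem A) × Cofinal A _<_ (IsLineElem A)) ×
    ((∀ l → Cofinal A _<_ (PointsOn A l)) ×
     (∀ p → Cofinal A _<_ (LinesThrough A p)))
lemma4p3 A plane@(join , meet) nondeg _ _<_ hf@((_ , <-tri) , _) =
  (cofinal-⊆ {A = A} on-is-point (on-line l₀) , cofinal-⊆ {A = A} through-is-line (through-point p₀)) ,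
  (on-line , through-point)
  where
  open IncidenceStructure A

  thick : Thick A
  thick = nonDegenerate⇒thick A join meet (point-≟ A (tri⇒dec≈ <-tri)) (line-≟ A (tri⇒dec≈ <-tri)) nondeg

  on-line : ∀ l → Cofinal A _<_ (PointsOn A l)
  on-line = pointsOn-cofinal plane thick hf

  through-point : ∀ p → Cofinal A _<_ (LinesThrough A p)
  through-point = linesThrough-cofinal plane thick hf

  p₀ : Point
  p₀ = proj₁ nondeg

  l₀ : Line
  l₀ = ThreePointsOn.p₁ (proj₂ thick p₀)

  on-is-point : ∀ {e} → PointsOn A l₀ e → IsPointElem A e
  on-is-point {inj₁ _} _ = lift tt

  through-is-line : ∀ {e} → LinesThrough A p₀ e → IsLineElem A e
  through-is-line {inj₂ _} _ = lift tt
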